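{- Let $q$ be a prime power and $m$ a positive integer. For each $i\in\{1,2\}$ let $\mathbf{n}^{(i)}=(n^{(i)}_1,\dots,n^{(i)}_{t_i})$, $N_i=n^{(i)}_1+\cdots+n^{(i)}_{t_i}$, and let $\mathcal{U}^{(i)}$ be a sum-rank $\rho_i$-saturating $[\mathbf{n}^{(i)},k_i]_{q^m/q}$ system associated with the code $\mathcal{C}_i\subseteq\mathbb{F}_{q^m}^{N_i}$. Let $f:\mathbb{F}_{q^m}^{N_1}\to\mathbb{F}_{q^m}^{N_2}$ be an $\mathbb{F}_{q^m}$-linear map. Then the $f$-sum $\mathcal{U}^{(1)}\oplus_f\mathcal{U}^{(2)}$ is an $[(\mathbf{n}^{(1)},\mathbf{n}^{(2)}),k_1+k_2]_{q^m/q}$ system that is sum-rank $\rho$-saturating for some $\rho\le\rho_1+\rho_2$. In particular, if $\rho_1+\rho_2\le\min\{k_1+k_2,m\}$, then \[s_{q^m/q}(k_1+k_2,\rho_1+\rho_2,t_1+t_2)\le s_{q^m/q}(k_1,\rho_1,t_1)+s_{q^m/q}(k_2,\rho_2,t_2).\]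
   Context: An $[\mathbf{n},k]_{q^m/q}$ system ($\mathbf{n}=(n_1,\dots,n_t)$) is a tuple $(\mathcal{U}_1,\dots,\mathcal{U}_t)$ of $\mathbb{F}_q$-subspaces of $\mathbb{F}_{q^m}^k$ with $\dim_{\mathbb{F}_q}\mathcal{U}_i=n_i$ whose union spans $\mathbb{F}_{q^m}^k$ over $\mathbb{F}_{q^m}$. A generator matrix is $G=[G_1|\cdots|G_t]$, $G_j\in\mathbb{F}_{q^m}^{k\times n_j}$ with columns spanning $\mathcal{U}_j$ over $\mathbb{F}_q$; the code associated to the system is the $\mathbb{F}_{q^m}$-row space of $G$ in $\mathbb{F}_{q^m}^{N}=\mathbb{F}_{q^m}^{n_1}\oplus\cdots\oplus\mathbb{F}_{q^m}^{n_t}$, and conversely the system associated to a code with generator matrix $G$ (of full row rank $k$) is the tuple of $\mathbb{F}_q$-column spans of the blocks $G_j$. The $f$-sum of $\mathcal{C}_1,\mathcal{C}_2$ is $\mathcal{C}=\{(u,f(u)+v):u\in\mathcal{C}_1,v\in\mathcal{C}_2\}\subseteq\mathbb{F}_{q^m}^{N_1+N_2}$, with block structure $(\mathbf{n}^{(1)},\mathbf{n}^{(2)})$; if $G^{(i)}$ generates $\mathcal{C}_i$, then $\mathcal{C}$ is generated by $\begin{bmatrix}G^{(1)} & f(G^{(1)})\\ 0 & G^{(2)}\end{bmatrix}$, where $f(G^{(1)})$ has as rows the images under $f$ of the rows of $G^{(1)}$. The $f$-sum $\mathcal{U}^{(1)}\oplus_f\mathcal{U}^{(2)}$ is the system associated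 to $\mathcal{C}$. For an $\mathbb{F}_q$-subspace $W$, $L_W=\{\langle u\rangle_{\mathbb{F}_{q^m}}:u\in W\setminus\{0\}\}$. A point set $\mathcal{S}$ in $\mathrm{PG}(k-1,q^m)$ is $s$-saturating if every point lies in the $\mathbb{F}_{q^m}$-span of some $s+1$ points of $\mathcal{S}$ and $s$ is minimal with this property; a system is sum-rank $\rho$-saturating if the union of the linear sets of its components is $(\rho-1)$-saturating. $s_{q^m/q}(k,\rho,t)$ denotes the minimum of $\sum_{i=1}^t\dim_{\mathbb{F}_q}\mathcal{U}_i$ over all $t$-tuples $(\mathcal{U}_1,\dots,\mathcal{U}_t)$ of $\mathbb{F}_q$-subspaces of $\mathbb{F}_{q^m}^k$ forming a sum-rank $\rho$-saturating system. -}

module Defs where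

open import Level using (0ℓ)
open import Algebra.Bundles using (CommutativeRing)
open import Data.Nat using (ℕ; zero; suc)
import Data.Nat as N
open import Data.Nat.Primality using (Prime)
open import Data.Fin using (Fin; splitAt)
import Data.Fin as F
open import Data.Sum using (_⊎_; inj₁; inj₂; [_,_]′)
open import Data.Product using (Σ; ∃; ∃-syntax; _×_; _,_)
open import Relation.Nullary using (¬_)
open import Relation.Binary.PropositionalEquality using (_≡_)

IsPrimePower : ℕ → Set
IsPrimePower q = ∃[ p ] ∃[ e ] (Prime p × 1 N.≤ e × q ≡ p N.^ e)

∑ℕ : (t : ℕ) → (Fin t → ℕ) → ℕ
∑ℕ zero    n = 0
∑ℕ (suc t) n = n F.zero N.+ ∑ℕ t (λ j → n (F.suc j))

_++ᶠ_ : ∀ {a} {A : Set a} {t1 t2 : ℕ} → (Fin t1 → A) → (Fin t2 → A) → Fin (t1 N.+ t2) → A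
_++ᶠ_ {t1 = t1} f g j = [ f , g ]′ (splitAt t1 j)

-- K is a field (commutative ring with 0 ≠ 1 and inverses of nonzero
-- elements) with exactly q^m elements; InF is the subfield F_q of K,
-- which has exactly q elements.

record Extension (q m : ℕ) : Set₁ where
  field
    Kring : CommutativeRing 0ℓ 0ℓ
  open CommutativeRing Kring public
  field
    0≉1     : ¬ (0# ≈ 1#)
    inverse : ∀ x → ¬ (x ≈ 0#) → ∃[ y ] (x * y ≈ 1#)
    enumK       : Fin (q N.^ m) → Carrier
    enumK-inj   : ∀ i j → enumK i ≈ enumK j → i ≡ j
    enumK-surj  : ∀ x → ∃[ i ] (enumK i ≈ x)
    InF       : Carrier → Set
    InF-resp  : ∀ {x y} → x ≈ y → InF x → InF y
    InF-0     : InF 0#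
    InF-1     : InF 1#
    InF-+     : ∀ {x y} → InF x → InF y → InF (x + y)
    InF-neg   : ∀ {x} → InF x → InF (- x)
    InF-*     : ∀ {x y} → InF x → InF y → InF (x * y)
    InF-inv   : ∀ {x y} → InF x → x * y ≈ 1# → InF y
    enumF      : Fin q → Carrier
    enumF-InF  : ∀ i → InF (enumF i)
    enumF-inj  : ∀ i j → enumF i ≈ enumF j → i ≡ j
    enumF-surj : ∀ x → InF x → ∃[ i ] (enumF i ≈ x)

module Over {q m : ℕ} (E : Extension q m) where
  open Extension E

  Vec : ℕ → Set
  Vec k = Fin k → Carrier

  _≋_ : ∀ {k} → Vec k → Vec k → Set
  u ≋ v = ∀ i → u i ≈ v i

  0ᵛ : ∀ {k} → Vec k
  0ᵛ _ = 0#

  ∑ : (r : ℕ) → (Fin r → Carrier) → Carrier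
  ∑ zero    a = 0#
  ∑ (suc r) a = a F.zero + ∑ r (λ i → a (F.suc i))

  lincomb : ∀ {k r} → (Fin r → Carrier) → (Fin r → Vec k) → Vec k
  lincomb {r = r} c w x = ∑ r (λ i → c i * w i x)

  InKSpan : ∀ {k r} → Vec k → (Fin r → Vec k) → Set
  InKSpan v w = ∃[ c ] (v ≋ lincomb c w)

  InFSpan : ∀ {k r} → Vec k → (Fin r → Vec k) → Set
  InFSpan v w = ∃[ c ] ((∀ i → InF (c i)) × (v ≋ lincomb c w))

  FIndependent : ∀ {k r} → (Fin r → Vec k) → Set
  FIndependent w = ∀ c → (∀ i → InF (c i)) → lincomb c w ≋ 0ᵛ → ∀ i → c i ≈ 0#

  Subsp : ℕ → Set₁
  Subsp k = Vec k → Set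

  IsFSubspace : ∀ {k} → Subsp k → Set
  IsFSubspace U =
      (∀ {u v} → u ≋ v → U u → U v)
    × U 0ᵛ
    × (∀ {u v} → U u → U v → U (λ x → u x + v x))
    × (∀ {a u} → InF a → U u → U (λ x → a * u x))

  HasFDim : ∀ {k} → Subsp k → ℕ → Set
  HasFDim U n = ∃[ b ] ((∀ i → U (b i)) × FIndependent {r = n} b × (∀ u → U u → InFSpan u b))

  InUnion : ∀ {k t} → (Fin t → Subsp k) → Vec k → Set
  InUnion U u = ∃[ j ] U j u

  IsSystem : ∀ {k t} → (n : Fin t → ℕ) → (Fin t → Subsp k) → Set
  IsSystem {k} n U =
      (∀ j → IsFSubspace (U j))
    × (∀ j → HasFDim (U j) (n j))
    × (∀ (v : Vec k) → ∃[ r ] Σ (Fin r → Vec k) λ w → ((∀ i → InUnion U (w i)) × InKSpan v w))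

  -- Every point <v> of PG(k-1,q^m) lies in the K-span of some r points of
  -- the union of the linear sets L_{U_j}; a point of L_{U_j} is <u> with
  -- u ∈ U_j \ {0}, so such points are given by nonzero representatives.
  CoveredBy : ∀ {k t} → ℕ → (Fin t → Subsp k) → Set
  CoveredBy {k} r U =
    ∀ (v : Vec k) → ¬ (v ≋ 0ᵛ) →
      Σ (Fin r → Vec k) λ w → ((∀ i → InUnion U (w i) × ¬ (w i ≋ 0ᵛ)) × InKSpan v w)

  -- sum-rank ρ-saturating: the union of the linear sets is (ρ-1)-saturating,
  -- i.e. every point lies in the span of some ρ points and ρ is minimal.
  SumRankSaturating : ∀ {k t} → ℕ → (Fin t → Subsp k) → Set
  SumRankSaturating ρ U = CoveredBy ρ U × (∀ r → CoveredBy r U → ρ N.≤ r)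

  IsSValue : (k ρ t s : ℕ) → Set₁
  IsSValue k ρ t s =
      (∃[ U ] ∃[ n ] (IsSystem {k} {t} n U × SumRankSaturating ρ U × ∑ℕ t n ≡ s))
    × (∀ (U : Fin t → Subsp k) n → IsSystem n U → SumRankSaturating ρ U → s N.≤ ∑ℕ t n)

  -- Codes in block form: K^N = K^{n_1} ⊕ ... ⊕ K^{n_t}

  BVec : (t : ℕ) → (Fin t → ℕ) → Set
  BVec t n = (j : Fin t) → Fin (n j) → Carrier

  IsKLinear : ∀ {t1 t2 n1 n2} → (BVec t1 n1 → BVec t2 n2) → Set
  IsKLinear {t1} {t2} {n1} {n2} f =
      (∀ u v → (∀ j c → u j c ≈ v j c) → ∀ j c → f u j c ≈ f v j c)
    × (∀ u v j c → f (λ j' c' → u j' c' + v j' c') j c ≈ f u j c + f v j c)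
    × (∀ a u j c → f (λ j' c' → a * u j' c') j c ≈ a * f u j c)

  -- generator matrix G = [G_1 | ... | G_t], G_j ∈ K^{k × n_j};
  -- G j r c is the entry in row r, column c of block G_j
  GenMat : ℕ → (t : ℕ) → (Fin t → ℕ) → Set
  GenMat k t n = (j : Fin t) → Fin k → Fin (n j) → Carrier

  column : ∀ {k t n} → GenMat k t n → (j : Fin t) → Fin (n j) → Vec k
  column G j c r = G j r c

  systemOf : ∀ {k t n} → GenMat k t n → Fin t → Subsp k
  systemOf G j v = InFSpan v (column G j)

  IsGenMatOf : ∀ {k t n} → GenMat k t n → (Fin t → Subsp k) → Set
  IsGenMatOf {k} G U = ∀ j (v : Vec k) → (U j v → systemOf G j v) × (systemOf G j v → U j v)

  row : ∀ {k t n} → GenMat k t n → Fin k → BVec t n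
  row G r j c = G j r c

  -- generator matrix of the f-sum:  [ G1  f(G1) ; 0  G2 ]
  fSumGenMat : ∀ {k1 k2 t1 t2 n1 n2} → GenMat k1 t1 n1 → GenMat k2 t2 n2 →
               (BVec t1 n1 → BVec t2 n2) →
               GenMat (k1 N.+ k2) (t1 N.+ t2) (n1 ++ᶠ n2)
  fSumGenMat {k1} {k2} {t1} {t2} {n1} {n2} G1 G2 f j with splitAt t1 j
  ... | inj₁ j1 = λ r c → [ (λ r1 → G1 j1 r1 c) , (λ _ → 0#) ]′ (splitAt k1 r)
  ... | inj₂ j2 = λ r c → [ (λ r1 → f (row G1 r1) j2 c) , (λ r2 → G2 j2 r2 c) ]′ (splitAt k1 r)

  fSumSystem : ∀ {k1 k2 t1 t2 n1 n2} → GenMat k1 t1 n1 → GenMat k2 t2 n2 →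
               (BVec t1 n1 → BVec t2 n2) → Fin (t1 N.+ t2) → Subsp (k1 N.+ k2)
  fSumSystem G1 G2 f = systemOf (fSumGenMat G1 G2 f)

module Submission where

-- Let G = [G₁ f(G₁); 0 G₂] be the generator matrix of the f-sum. Its first t₁ blocks span the
-- subspaces U⁽¹⁾_j × 0, and dropping the first k₁ coordinates maps its last t₂ blocks onto U⁽²⁾_j;
-- so its columns stay F_q-independent (n spanning vectors of an n-dimensional F_q-space are
-- independent, by counting) and the f-sum is a system. Every vector v lies in the span of ρ₁ + ρ₂
-- points: lift a cover of the lower half of v by ρ₂ points of the last blocks and cover what remains
-- of the upper half by ρ₁ points of the first blocks. Everything is finite, hence decidable, so the
-- least such number ρ ≤ ρ₁ + ρ₂ exists. For f = 0 every point lies in one of the two halves, so a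
-- cover of (v₁, v₂) splits into covers of v₁ and of v₂; taking vᵢ that need ρᵢ points shows that
-- the direct sum is exactly (ρ₁ + ρ₂)-saturating, of dimension Σ n⁽¹⁾ + Σ n⁽²⁾.

open import Defs
open import Level using (0ℓ)
open import Data.Nat as ℕ using (ℕ; zero; suc; _≤_; z≤n; s≤s; _^_)
import Data.Nat.Properties as ℕ
open import Data.Fin as Fin using (Fin; splitAt; _↑ˡ_; _↑ʳ_; finToFun; funToFin)
import Data.Fin.Properties as Fin
open import Data.Vec.Functional using (_++_; take; drop)
open import Data.Vec.Functional.Properties using (lookup-++ˡ; lookup-++ʳ)
import Data.Vec.Functional.Relation.Binary.Equality.Setoid as VecSetoid
open import Data.Product using (Σ; ∃; ∃₂; ∃-syntax; _×_; _,_; proj₁; proj₂)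
open import Data.Sum using (_⊎_; inj₁; inj₂)
open import Data.Empty using (⊥-elim)
open import Function using (_∘_; _$_)
open import Function.Definitions using (Injective)
open import Relation.Nullary using (¬_; Dec; yes; no)
open import Relation.Nullary.Decidable using (map′; ¬?; _×-dec_; _→-dec_; decidable-stable)
open import Relation.Unary using (Pred; Decidable)
open import Relation.Binary using (Setoid; _Respects_)
import Relation.Binary.Construct.On as On
import Relation.Binary.Reasoning.Setoid
open import Relation.Binary.PropositionalEquality as ≡ using (_≡_; cong; cong₂)

least-≤ : (P : ℕ → Set) → Decidable P → ∀ n → P n →
          ∃[ ρ ] (ρ ≤ n × P ρ × ∀ r → P r → ρ ≤ r)
least-≤ P P? n Pn with P? 0
... | yes P0 = 0 , z≤n , P0 , λ _ _ → z≤n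
least-≤ P P? zero    Pn | no ¬P0 = ⊥-elim (¬P0 Pn)
least-≤ P P? (suc n) Pn | no ¬P0 with least-≤ (P ∘ suc) (P? ∘ suc) n Pn
... | ρ , ρ≤n , Pρ , minimal = suc ρ , s≤s ρ≤n , Pρ , λ
  { zero P0 → ⊥-elim (¬P0 P0)
  ; (suc r) Pr → s≤s (minimal r Pr) }

injective⇒surjective : ∀ {n} (f : Fin n → Fin n) → Injective _≡_ _≡_ f → ∀ j → ∃[ i ] f i ≡ j
injective⇒surjective {suc n} f f-injective j with Fin.any? (λ i → f i Fin.≟ j)
... | yes found = found
... | no missed = ⊥-elim (ℕ.1+n≰n (Fin.injective⇒≤ g-injective))
  where
  g : Fin (suc n) → Fin n
  g i = Fin.punchOut {i = j} {j = f i} λ j≡fi → missed (i , ≡.sym j≡fi)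
  g-injective : Injective _≡_ _≡_ g
  g-injective = f-injective ∘ Fin.punchOut-injective {i = j} _ _

funToFin-cong : ∀ {m n} {f g : Fin m → Fin n} → (∀ i → f i ≡ g i) → funToFin f ≡ funToFin g
funToFin-cong {zero}  _   = ≡.refl
funToFin-cong {suc m} f≗g = cong₂ Fin.combine (f≗g Fin.zero) (funToFin-cong (f≗g ∘ Fin.suc))

module _ (S : Setoid 0ℓ 0ℓ) where
  open Setoid S

  record Enumeration : Set where
    field
      size           : ℕ
      enum           : Fin size → Carrier
      index          : Carrier → Fin size
      enum-index     : ∀ x → enum (index x) ≈ x
      enum-injective : ∀ {i j} → enum i ≈ enum j → i ≡ j

module Enumerable {S : Setoid 0ℓ 0ℓ} (𝓔 : Enumeration S) where
  open Setoid S
  open Enumeration 𝓔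

  _≟_ : (x y : Carrier) → Dec (x ≈ y)
  x ≟ y = map′ (λ e → trans (sym (enum-index x)) (trans (reflexive (cong enum e)) (enum-index y)))
               (λ x≈y → enum-injective (trans (enum-index x) (trans x≈y (sym (enum-index y)))))
               (index x Fin.≟ index y)

  ∃? : {P : Pred Carrier 0ℓ} → P Respects _≈_ → Decidable P → Dec (∃ P)
  ∃? resp P? = map′ (λ (i , Pi) → enum i , Pi) (λ (x , Px) → index x , resp (sym (enum-index x)) Px)
                    (Fin.any? (P? ∘ enum))

  ∀? : {P : Pred Carrier 0ℓ} → P Respects _≈_ → Decidable P → Dec (∀ x → P x)
  ∀? resp P? = map′ (λ all x → resp (enum-index x) (all (index x))) (λ all → all ∘ enum)
                    (Fin.all? (P? ∘ enum))

  injective⇒onto : (φ : Carrier → Carrier) → (∀ {x y} → φ x ≈ φ y → x ≈ y) → ∀ y → ∃[ x ] φ x ≈ y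
  injective⇒onto φ φ-injective y =
    let (i , Ψi≡) = injective⇒surjective Ψ Ψ-injective (index y)
    in enum i , (begin
      φ (enum i)               ≈⟨ sym (enum-index _) ⟩
      enum (Ψ i)               ≡⟨ cong enum Ψi≡ ⟩
      enum (index y)           ≈⟨ enum-index y ⟩
      y                        ∎)
    where
    open import Relation.Binary.Reasoning.Setoid S
    Ψ : Fin size → Fin size
    Ψ = index ∘ φ ∘ enum
    Ψ-injective : Injective _≡_ _≡_ Ψ
    Ψ-injective {i} {j} Ψi≡Ψj = enum-injective (φ-injective (begin
      φ (enum i)           ≈⟨ sym (enum-index _) ⟩
      enum (Ψ i)           ≡⟨ cong enum Ψi≡Ψj ⟩
      enum (Ψ j)           ≈⟨ enum-index _ ⟩
      φ (enum j)           ∎))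

Π-enumeration : ∀ {S} → Enumeration S → ∀ n → Enumeration (VecSetoid.≋-setoid S n)
Π-enumeration {S} 𝓔 n = record
  { size           = size ^ n
  ; enum           = λ i x → enum (finToFun i x)
  ; index          = λ v → funToFin (index ∘ v)
  ; enum-index     = λ v x → trans (reflexive (cong enum (Fin.finToFun-funToFin (index ∘ v) x)))
                                   (enum-index (v x))
  ; enum-injective = λ {i} {j} e → ≡.trans (≡.sym (Fin.funToFin-finToFin {n} {size} i))
                       (≡.trans (funToFin-cong (λ x → enum-injective (e x))) (Fin.funToFin-finToFin {n} {size} j))
  }
  where open Setoid S; open Enumeration 𝓔

∑ℕ-cong : ∀ {t} {a b : Fin t → ℕ} → (∀ i → a i ≡ b i) → ∑ℕ t a ≡ ∑ℕ t b
∑ℕ-cong {zero}  _   = ≡.refl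
∑ℕ-cong {suc t} a≗b = cong₂ ℕ._+_ (a≗b Fin.zero) (∑ℕ-cong (a≗b ∘ Fin.suc))

∑ℕ-splitAt : ∀ t₁ {t₂} (a : Fin (t₁ ℕ.+ t₂) → ℕ) →
             ∑ℕ (t₁ ℕ.+ t₂) a ≡ ∑ℕ t₁ (take t₁ a) ℕ.+ ∑ℕ t₂ (drop t₁ a)
∑ℕ-splitAt zero     a = ≡.refl
∑ℕ-splitAt (suc t₁) a =
  ≡.trans (cong (a Fin.zero ℕ.+_) (∑ℕ-splitAt t₁ (a ∘ Fin.suc))) (≡.sym (ℕ.+-assoc (a Fin.zero) _ _))

∑ℕ-++ : ∀ {t₁ t₂} (n₁ : Fin t₁ → ℕ) (n₂ : Fin t₂ → ℕ) →
        ∑ℕ (t₁ ℕ.+ t₂) (n₁ ++ᶠ n₂) ≡ ∑ℕ t₁ n₁ ℕ.+ ∑ℕ t₂ n₂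
∑ℕ-++ {t₁} n₁ n₂ = ≡.trans (∑ℕ-splitAt t₁ (n₁ ++ᶠ n₂))
  (cong₂ ℕ._+_ (∑ℕ-cong (lookup-++ˡ n₁ n₂)) (∑ℕ-cong (lookup-++ʳ n₁ n₂)))

all-++ : ∀ {A : Set} {P : A → Set} {m n} {xs : Fin m → A} {ys : Fin n → A} →
         (∀ i → P (xs i)) → (∀ i → P (ys i)) → ∀ i → P ((xs ++ ys) i)
all-++ {m = m} Pxs Pys i with splitAt m i
... | inj₁ i₁ = Pxs i₁
... | inj₂ i₂ = Pys i₂

module SumRankSystems {q m : ℕ} (E : Extension q m) where
  open Extension E hiding (zero)
  open Over E
  open import Algebra.Properties.CommutativeSemigroup +-commutativeSemigroup using (interchange)
  open import Algebra.Properties.AbelianGroup +-abelianGroup using (⁻¹-∙-comm)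
  open import Algebra.Properties.Group +-group
    using (ε⁻¹≈ε; x∙y⁻¹≈ε⇒x≈y; x≈y⇒x∙y⁻¹≈ε; //-rightDividesˡ)
  open import Algebra.Properties.Ring ring using (-‿distribˡ-*)
  open VecSetoid setoid using (≋-refl; ≋-sym; ≋-trans; ≋-setoid)

  module ≈-Reasoning = Relation.Binary.Reasoning.Setoid setoid
  module ≋-Reasoning {k : ℕ} = Relation.Binary.Reasoning.Setoid (≋-setoid k)

  infixl 6 _+ᵛ_ _-ᵛ_
  infixr 7 _*ᵛ_

  _+ᵛ_ _-ᵛ_ : ∀ {k} → Vec k → Vec k → Vec k
  (u +ᵛ v) x = u x + v x
  (u -ᵛ v) x = u x - v x

  _*ᵛ_ : ∀ {k} → Carrier → Vec k → Vec k
  (a *ᵛ v) x = a * v x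

  ∑-cong : ∀ r {a b : Vec r} → a ≋ b → ∑ r a ≈ ∑ r b
  ∑-cong zero    _   = refl
  ∑-cong (suc r) a≋b = +-cong (a≋b Fin.zero) (∑-cong r (a≋b ∘ Fin.suc))

  ∑-0 : ∀ r → ∑ r 0ᵛ ≈ 0#
  ∑-0 zero    = refl
  ∑-0 (suc r) = trans (+-identityˡ _) (∑-0 r)

  ∑-+ : ∀ r (a b : Vec r) → ∑ r (a +ᵛ b) ≈ ∑ r a + ∑ r b
  ∑-+ zero    _ _ = sym (+-identityˡ 0#)
  ∑-+ (suc r) a b = trans (+-congˡ (∑-+ r (a ∘ Fin.suc) (b ∘ Fin.suc))) (interchange (a Fin.zero) (b Fin.zero) _ _)

  ∑-neg : ∀ r (a : Vec r) → ∑ r (λ i → - a i) ≈ - ∑ r a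
  ∑-neg zero    _ = sym ε⁻¹≈ε
  ∑-neg (suc r) a = trans (+-congˡ (∑-neg r (a ∘ Fin.suc))) (⁻¹-∙-comm _ _)

  ∑-*ˡ : ∀ r x (a : Vec r) → x * ∑ r a ≈ ∑ r (x *ᵛ a)
  ∑-*ˡ zero    x _ = zeroʳ x
  ∑-*ˡ (suc r) x a = trans (distribˡ x _ _) (+-congˡ (∑-*ˡ r x (a ∘ Fin.suc)))

  ∑-*ʳ : ∀ r x (a : Vec r) → ∑ r a * x ≈ ∑ r (λ i → a i * x)
  ∑-*ʳ zero    x _ = zeroˡ x
  ∑-*ʳ (suc r) x a = trans (distribʳ x _ _) (+-congˡ (∑-*ʳ r x (a ∘ Fin.suc)))

  ∑-comm : ∀ r s (a : Fin r → Fin s → Carrier) → ∑ r (λ i → ∑ s (a i)) ≈ ∑ s (λ l → ∑ r (λ i → a i l))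
  ∑-comm zero    s _ = sym (∑-0 s)
  ∑-comm (suc r) s a = trans (+-congˡ (∑-comm r s (a ∘ Fin.suc))) (sym (∑-+ s _ _))

  ∑-splitAt : ∀ r₁ {r₂} (a : Vec (r₁ ℕ.+ r₂)) →
              ∑ (r₁ ℕ.+ r₂) a ≈ ∑ r₁ (take r₁ a) + ∑ r₂ (drop r₁ a)
  ∑-splitAt zero     a = sym (+-identityˡ _)
  ∑-splitAt (suc r₁) a = trans (+-congˡ (∑-splitAt r₁ (a ∘ Fin.suc))) (sym (+-assoc (a Fin.zero) _ _))

  x≈0⇒a*x+y≈y : ∀ a y {x} → x ≈ 0# → a * x + y ≈ y
  x≈0⇒a*x+y≈y a y x≈0 = trans (+-congʳ (trans (*-congˡ x≈0) (zeroʳ a))) (+-identityˡ y)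

  δ : ∀ {n} → Fin n → Fin n → Carrier
  δ i j with i Fin.≟ j
  ... | yes _ = 1#
  ... | no  _ = 0#

  δ-sym : ∀ {n} (i j : Fin n) → δ i j ≈ δ j i
  δ-sym i j with i Fin.≟ j | j Fin.≟ i
  ... | yes _   | yes _   = refl
  ... | no  _   | no  _   = refl
  ... | yes i≡j | no  j≢i = ⊥-elim (j≢i (≡.sym i≡j))
  ... | no  i≢j | yes j≡i = ⊥-elim (i≢j (≡.sym j≡i))

  ∑-δ : ∀ {r} (i : Fin r) (a : Vec r) → ∑ r (λ j → δ i j * a j) ≈ a i
  ∑-δ {suc r} Fin.zero a = begin
    1# * a Fin.zero + ∑ r (λ j → 0# * a (Fin.suc j)) ≈⟨ +-cong (*-identityˡ _) (∑-cong r (λ j → zeroˡ _)) ⟩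
    a Fin.zero + ∑ r 0ᵛ                                ≈⟨ +-congˡ (∑-0 r) ⟩
    a Fin.zero + 0#                                    ≈⟨ +-identityʳ _ ⟩
    a Fin.zero                                         ∎
    where open ≈-Reasoning
  ∑-δ {suc r} (Fin.suc i) a = begin
    0# * a Fin.zero + ∑ r (λ j → δ (Fin.suc i) (Fin.suc j) * a (Fin.suc j))
      ≈⟨ +-cong (zeroˡ _) (∑-cong r (λ j → *-congʳ (δ-suc j))) ⟩
    0# + ∑ r (λ j → δ i j * a (Fin.suc j)) ≈⟨ +-identityˡ _ ⟩
    ∑ r (λ j → δ i j * a (Fin.suc j))      ≈⟨ ∑-δ i (a ∘ Fin.suc) ⟩
    a (Fin.suc i)                          ∎
    where
    open ≈-Reasoning
    δ-suc : ∀ j → δ (Fin.suc i) (Fin.suc j) ≈ δ i j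
    δ-suc j with i Fin.≟ j
    ... | yes _ = refl
    ... | no  _ = refl

  lincomb-congˡ : ∀ {k r} {c c' : Vec r} (w : Fin r → Vec k) → c ≋ c' → lincomb c w ≋ lincomb c' w
  lincomb-congˡ {r = r} w c≋c' x = ∑-cong r (λ i → *-congʳ (c≋c' i))

  lincomb-congʳ : ∀ {k r} (c : Vec r) {w w' : Fin r → Vec k} → (∀ i → w i ≋ w' i) → lincomb c w ≋ lincomb c w'
  lincomb-congʳ {r = r} c w≋w' x = ∑-cong r (λ i → *-congˡ (w≋w' i x))

  lincomb-0ᶜ : ∀ {k r} (w : Fin r → Vec k) → lincomb 0ᵛ w ≋ 0ᵛ
  lincomb-0ᶜ {r = r} w x = trans (∑-cong r (λ i → zeroˡ (w i x))) (∑-0 r)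

  lincomb-0ʷ : ∀ {k r} (c : Vec r) → lincomb c (λ _ → 0ᵛ {k}) ≋ 0ᵛ
  lincomb-0ʷ {r = r} c x = trans (∑-cong r (λ i → zeroʳ (c i))) (∑-0 r)

  lincomb-+ᶜ : ∀ {k r} (c d : Vec r) (w : Fin r → Vec k) → lincomb (c +ᵛ d) w ≋ (lincomb c w +ᵛ lincomb d w)
  lincomb-+ᶜ {r = r} c d w x = trans (∑-cong r (λ i → distribʳ (w i x) (c i) (d i))) (∑-+ r _ _)

  lincomb-*ᶜ : ∀ {k r} a (c : Vec r) (w : Fin r → Vec k) → lincomb (a *ᵛ c) w ≋ (a *ᵛ lincomb c w)
  lincomb-*ᶜ {r = r} a c w x = trans (∑-cong r (λ i → *-assoc a (c i) (w i x))) (sym (∑-*ˡ r a _))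

  lincomb--ᶜ : ∀ {k r} (c d : Vec r) (w : Fin r → Vec k) → lincomb (c -ᵛ d) w ≋ (lincomb c w -ᵛ lincomb d w)
  lincomb--ᶜ {r = r} c d w x = begin
    ∑ r (λ i → (c i - d i) * w i x)            ≈⟨ ∑-cong r (λ i → distribʳ (w i x) (c i) (- d i)) ⟩
    ∑ r (λ i → c i * w i x + - d i * w i x)     ≈⟨ ∑-+ r (λ i → c i * w i x) _ ⟩
    lincomb c w x + ∑ r (λ i → - d i * w i x)   ≈⟨ +-congˡ (∑-cong r (λ i → sym (-‿distribˡ-* (d i) (w i x)))) ⟩
    lincomb c w x + ∑ r (λ i → - (d i * w i x)) ≈⟨ +-congˡ (∑-neg r (λ i → d i * w i x)) ⟩
    lincomb c w x - lincomb d w x               ∎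
    where open ≈-Reasoning

  lincomb-δ : ∀ {k r} (i : Fin r) (w : Fin r → Vec k) → lincomb (δ i) w ≋ w i
  lincomb-δ i w x = ∑-δ i (λ j → w j x)

  lincomb-δʳ : ∀ {r} (y : Vec r) → lincomb y δ ≋ y
  lincomb-δʳ {r} y l = trans (∑-cong r (λ i → trans (*-comm (y i) _) (*-congʳ (δ-sym i l)))) (∑-δ l y)

  lincomb-assoc : ∀ {k r s} (c : Vec r) (M : Fin r → Vec s) (w : Fin s → Vec k) →
                  lincomb c (λ i → lincomb (M i) w) ≋ lincomb (lincomb c M) w
  lincomb-assoc {r = r} {s} c M w x = begin
    ∑ r (λ i → c i * ∑ s (λ l → M i l * w l x))   ≈⟨ ∑-cong r (λ i → ∑-*ˡ s (c i) _) ⟩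
    ∑ r (λ i → ∑ s (λ l → c i * (M i l * w l x))) ≈⟨ ∑-comm r s _ ⟩
    ∑ s (λ l → ∑ r (λ i → c i * (M i l * w l x))) ≈⟨ ∑-cong s (λ l → ∑-cong r (λ i → sym (*-assoc _ _ _))) ⟩
    ∑ s (λ l → ∑ r (λ i → c i * M i l * w l x))   ≈⟨ ∑-cong s (λ l → sym (∑-*ʳ r (w l x) _)) ⟩
    ∑ s (λ l → lincomb c M l * w l x)             ∎
    where open ≈-Reasoning

  lincomb-++ : ∀ {k r₁ r₂} (c : Vec r₁) (d : Vec r₂) (v : Fin r₁ → Vec k) (w : Fin r₂ → Vec k) →
               lincomb (c ++ d) (v ++ w) ≋ (lincomb c v +ᵛ lincomb d w)
  lincomb-++ {r₁ = r₁} {r₂} c d v w x = trans (∑-splitAt r₁ _)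
    (+-cong (∑-cong r₁ (λ i → *-cong (reflexive (lookup-++ˡ c d i)) (reflexive (cong (_$ x) (lookup-++ˡ v w i)))))
            (∑-cong r₂ (λ i → *-cong (reflexive (lookup-++ʳ c d i)) (reflexive (cong (_$ x) (lookup-++ʳ v w i))))))

  K-enumeration : Enumeration setoid
  K-enumeration = record
    { size           = q ^ m
    ; enum           = enumK
    ; index          = proj₁ ∘ enumK-surj
    ; enum-index     = proj₂ ∘ enumK-surj
    ; enum-injective = enumK-inj _ _
    }

  Vec-enumeration : ∀ k → Enumeration (≋-setoid k)
  Vec-enumeration = Π-enumeration K-enumeration

  _≈?_ : (x y : Carrier) → Dec (x ≈ y)
  _≈?_ = Enumerable._≟_ K-enumeration

  _≋?_ : ∀ {k} (u v : Vec k) → Dec (u ≋ v)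
  _≋?_ {k} = Enumerable._≟_ (Vec-enumeration k)

  InF? : Decidable InF
  InF? x = map′ (λ (i , e) → InF-resp e (enumF-InF i)) (enumF-surj x) (Fin.any? λ i → enumF i ≈? x)

  𝔽 : Setoid 0ℓ 0ℓ
  𝔽 = On.setoid setoid (proj₁ {B = InF})

  𝔽-enumeration : Enumeration 𝔽
  𝔽-enumeration = record
    { size           = q
    ; enum           = λ i → enumF i , enumF-InF i
    ; index          = λ (x , x∈F) → proj₁ (enumF-surj x x∈F)
    ; enum-index     = λ (x , x∈F) → proj₂ (enumF-surj x x∈F)
    ; enum-injective = enumF-inj _ _
    }

  AllInF : ∀ {r} → Vec r → Set
  AllInF c = ∀ i → InF (c i)

  InF-∑ : ∀ r {a : Vec r} → AllInF a → InF (∑ r a)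
  InF-∑ zero    _   = InF-0
  InF-∑ (suc r) a∈F = InF-+ (a∈F Fin.zero) (InF-∑ r (a∈F ∘ Fin.suc))

  InF-δ : ∀ {n} (i : Fin n) → AllInF (δ i)
  InF-δ i j with i Fin.≟ j
  ... | yes _ = InF-1
  ... | no  _ = InF-0

  InF-lincomb : ∀ {r s} {c : Vec r} {M : Fin r → Vec s} → AllInF c → (∀ i → AllInF (M i)) → AllInF (lincomb c M)
  InF-lincomb {r} c∈F M∈F l = InF-∑ r (λ i → InF-* (c∈F i) (M∈F i l))

  span-isFSubspace : ∀ {k r} (w : Fin r → Vec k) → IsFSubspace (λ v → InFSpan v w)
  span-isFSubspace w =
      (λ u≋v (c , c∈F , u≋) → c , c∈F , ≋-trans (≋-sym u≋v) u≋)
    , (0ᵛ , (λ _ → InF-0) , ≋-sym (lincomb-0ᶜ w))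
    , (λ (c , c∈F , u≋) (d , d∈F , v≋) → c +ᵛ d , (λ i → InF-+ (c∈F i) (d∈F i)) ,
         λ x → trans (+-cong (u≋ x) (v≋ x)) (sym (lincomb-+ᶜ c d w x)))
    , (λ {a} a∈F (c , c∈F , u≋) → a *ᵛ c , (λ i → InF-* a∈F (c∈F i)) ,
         λ x → trans (*-congˡ (u≋ x)) (sym (lincomb-*ᶜ a c w x)))

  ∈-span : ∀ {k r} (w : Fin r → Vec k) i → InFSpan (w i) w
  ∈-span w i = δ i , InF-δ i , ≋-sym (lincomb-δ i w)

  span-⊆ : ∀ {k r} {U : Subsp k} {w : Fin r → Vec k} → IsFSubspace U → (∀ i → U (w i)) →
           ∀ {v} → InFSpan v w → U v
  span-⊆ {k} {U = U} (U-resp , U-0 , U-+ , U-*) w∈U (c , c∈F , v≋) = U-resp (≋-sym v≋) (lincomb∈U c∈F w∈U)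
    where
    lincomb∈U : ∀ {r} {c : Vec r} {w : Fin r → Vec k} → AllInF c → (∀ i → U (w i)) → U (lincomb c w)
    lincomb∈U {zero}  _   _   = U-0
    lincomb∈U {suc r} c∈F w∈U =
      U-+ (U-* (c∈F Fin.zero) (w∈U Fin.zero)) (lincomb∈U (c∈F ∘ Fin.suc) (w∈U ∘ Fin.suc))

  coordinates-unique : ∀ {k r} {w : Fin r → Vec k} {c d : Vec r} → FIndependent w → AllInF c → AllInF d →
                       lincomb c w ≋ lincomb d w → c ≋ d
  coordinates-unique {w = w} {c} {d} w-indep c∈F d∈F cw≋dw i = x∙y⁻¹≈ε⇒x≈y _ _
    (w-indep (c -ᵛ d) (λ j → InF-+ (c∈F j) (InF-neg (d∈F j)))
      (λ x → trans (lincomb--ᶜ c d w x) (x≈y⇒x∙y⁻¹≈ε (cw≋dw x))) i)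

  -- Matrices are families of rows, so lincomb y M is the row-vector product y M.
  -- Over F_q a left inverse is a right inverse: y ↦ y B is injective by y B A = y,
  -- hence onto since F_q^n is finite, and then (x A) B = x.
  left-inverse⇒right-inverse : ∀ {n} {A B : Fin n → Vec n} → (∀ i → AllInF (B i)) →
                               (∀ i → lincomb (B i) A ≋ δ i) → ∀ x → AllInF x → lincomb (lincomb x A) B ≋ x
  left-inverse⇒right-inverse {n} {A} {B} B∈F BA≋I x x∈F = begin
    lincomb (lincomb x A) B             ≈⟨ lincomb-congˡ B (lincomb-congˡ A (≋-sym yB≋x)) ⟩
    lincomb (lincomb (lincomb y B) A) B ≈⟨ lincomb-congˡ B (yBA≋y y) ⟩
    lincomb y B                         ≈⟨ yB≋x ⟩
    x                                   ∎
    where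
    open ≋-Reasoning

    yBA≋y : ∀ y → lincomb (lincomb y B) A ≋ y
    yBA≋y y = begin
      lincomb (lincomb y B) A           ≈⟨ ≋-sym (lincomb-assoc y B A) ⟩
      lincomb y (λ i → lincomb (B i) A) ≈⟨ lincomb-congʳ y BA≋I ⟩
      lincomb y δ                       ≈⟨ lincomb-δʳ y ⟩
      y                                 ∎

    _·B : (Fin n → Σ Carrier InF) → (Fin n → Σ Carrier InF)
    (y ·B) l = lincomb (proj₁ ∘ y) B l , InF-lincomb (proj₂ ∘ y) B∈F l

    ·B-onto : ∀ x → ∃[ y ] (∀ l → proj₁ ((y ·B) l) ≈ proj₁ (x l))
    ·B-onto = Enumerable.injective⇒onto (Π-enumeration 𝔽-enumeration n) _·B λ {y} {y'} yB≋y'B → begin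
      proj₁ ∘ y                          ≈⟨ ≋-sym (yBA≋y (proj₁ ∘ y)) ⟩
      lincomb (lincomb (proj₁ ∘ y) B) A  ≈⟨ lincomb-congˡ A yB≋y'B ⟩
      lincomb (lincomb (proj₁ ∘ y') B) A ≈⟨ yBA≋y (proj₁ ∘ y') ⟩
      proj₁ ∘ y'                         ∎

    y : Vec n
    y = proj₁ ∘ proj₁ (·B-onto (λ i → x i , x∈F i))

    yB≋x : lincomb y B ≋ x
    yB≋x = proj₂ (·B-onto (λ i → x i , x∈F i))

  same-span⇒independent : ∀ {k n} {b g : Fin n → Vec k} → FIndependent b →
                          (∀ i → InFSpan (b i) g) → (∀ i → InFSpan (g i) b) → FIndependent g
  same-span⇒independent {k} {n} {b} {g} b-indep b∈⟨g⟩ g∈⟨b⟩ x x∈F xg≋0 = begin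
    x                       ≈⟨ ≋-sym (left-inverse⇒right-inverse B∈F BA≋δ x x∈F) ⟩
    lincomb (lincomb x A) B ≈⟨ lincomb-congˡ B xA≋0 ⟩
    lincomb 0ᵛ B            ≈⟨ lincomb-0ᶜ B ⟩
    0ᵛ                      ∎
    where
    open ≋-Reasoning
    B A : Fin n → Vec n
    B i = proj₁ (b∈⟨g⟩ i)
    A i = proj₁ (g∈⟨b⟩ i)

    B∈F : ∀ i → AllInF (B i)
    B∈F i = proj₁ (proj₂ (b∈⟨g⟩ i))

    A∈F : ∀ i → AllInF (A i)
    A∈F i = proj₁ (proj₂ (g∈⟨b⟩ i))

    yA·b≋y·g : ∀ y → lincomb (lincomb y A) b ≋ lincomb y g
    yA·b≋y·g y = begin
      lincomb (lincomb y A) b           ≈⟨ ≋-sym (lincomb-assoc y A b) ⟩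
      lincomb y (λ c → lincomb (A c) b) ≈⟨ lincomb-congʳ y (λ c → ≋-sym (proj₂ (proj₂ (g∈⟨b⟩ c)))) ⟩
      lincomb y g                       ∎

    BA≋δ : ∀ i → lincomb (B i) A ≋ δ i
    BA≋δ i = coordinates-unique b-indep (InF-lincomb (B∈F i) A∈F) (InF-δ i) (begin
      lincomb (lincomb (B i) A) b ≈⟨ yA·b≋y·g (B i) ⟩
      lincomb (B i) g             ≈⟨ ≋-sym (proj₂ (proj₂ (b∈⟨g⟩ i))) ⟩
      b i                         ≈⟨ ≋-sym (lincomb-δ i b) ⟩
      lincomb (δ i) b             ∎)

    xA≋0 : lincomb x A ≋ 0ᵛ
    xA≋0 = b-indep (lincomb x A) (InF-lincomb x∈F A∈F) (≋-trans (yA·b≋y·g x) xg≋0)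

  ColumnsIndependent : ∀ {k t n} → GenMat k t n → Set
  ColumnsIndependent G = ∀ j → FIndependent (column G j)

  columns-independent : ∀ {k t n} {U : Fin t → Subsp k} {G : GenMat k t n} →
                        IsSystem n U → IsGenMatOf G U → ColumnsIndependent G
  columns-independent {G = G} (_ , dim , _) G≐U j =
    let (b , b∈U , b-indep , U⊆⟨b⟩) = dim j
    in same-span⇒independent b-indep (λ i → proj₁ (G≐U j (b i)) (b∈U i))
                                      (λ c → U⊆⟨b⟩ _ (proj₂ (G≐U j _) (∈-span (column G j) c)))

  columns-basis : ∀ {k t n} (G : GenMat k t n) j → FIndependent (column G j) → HasFDim (systemOf G j) (n j)
  columns-basis G j indep = column G j , ∈-span (column G j) , indep , λ _ v∈ → v∈

  basisMatrix : ∀ {k t n} {U : Fin t → Subsp k} → IsSystem n U → GenMat k t n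
  basisMatrix (_ , dim , _) j r c = proj₁ (dim j) c r

  basisMatrix-isGenMat : ∀ {k t n} {U : Fin t → Subsp k} (sys : IsSystem n U) → IsGenMatOf (basisMatrix sys) U
  basisMatrix-isGenMat (sub , dim , _) j v =
    let (_ , b∈U , _ , U⊆⟨b⟩) = dim j in U⊆⟨b⟩ v , span-⊆ (sub j) b∈U

  systemOf-resp : ∀ {k t n} (G : GenMat k t n) j → systemOf G j Respects _≋_
  systemOf-resp G j = proj₁ (span-isFSubspace (column G j))

  systemOf? : ∀ {k t n} (G : GenMat k t n) j → Decidable (systemOf G j)
  systemOf? G j v = Enumerable.∃? (Vec-enumeration _)
    (λ c≋c' (c∈F , v≋) → (λ i → InF-resp (c≋c' i) (c∈F i)) , ≋-trans v≋ (lincomb-congˡ (column G j) c≋c'))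
    (λ c → Fin.all? (InF? ∘ c) ×-dec (v ≋? lincomb c (column G j)))

  PointOf : ∀ {k t} → (Fin t → Subsp k) → Vec k → Set
  PointOf U w = InUnion U w × ¬ (w ≋ 0ᵛ)

  -- The body of CoveredBy as a record, so that r and U can be inferred from a cover.
  record Cover {k t} (r : ℕ) (U : Fin t → Subsp k) (v : Vec k) : Set where
    constructor cover
    field
      points  : Fin r → Vec k
      isPoint : ∀ i → PointOf U (points i)
      spans   : InKSpan v points

  Covers : ∀ {k t} → ℕ → (Fin t → Subsp k) → Set
  Covers {k} r U = ∀ (v : Vec k) → ¬ (v ≋ 0ᵛ) → Cover r U v

  covers⇒coveredBy : ∀ {k t r} {U : Fin t → Subsp k} → Covers r U → CoveredBy r U
  covers⇒coveredBy covers v v≢0 = let cover w pts span = covers v v≢0 in w , pts , span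

  coveredBy⇒covers : ∀ {k t r} {U : Fin t → Subsp k} → CoveredBy r U → Covers r U
  coveredBy⇒covers covered v v≢0 = let (w , pts , span) = covered v v≢0 in cover w pts span

  module _ {k t : ℕ} {U : Fin t → Subsp k} where

    cover-resp : ∀ {r} → Cover r U Respects _≋_
    cover-resp u≋v (cover w pts (c , u≋)) = cover w pts (c , ≋-trans (≋-sym u≋v) u≋)

    cover-empty : ∀ {v} → v ≋ 0ᵛ → Cover 0 U v
    cover-empty v≋0 = cover (λ ()) (λ ()) ((λ ()) , v≋0)

    cover-point : ∀ w → PointOf U w → ∀ a → Cover 1 U (a *ᵛ w)
    cover-point w pt a = cover (λ _ → w) (λ _ → pt) ((λ _ → a) , λ x → sym (+-identityʳ _))

    cover-+ : ∀ {a b u v} → Cover a U u → Cover b U v → Cover (a ℕ.+ b) U (u +ᵛ v)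
    cover-+ (cover w pts (c , u≋)) (cover w' pts' (c' , v≋)) =
      cover (w ++ w') (all-++ {P = PointOf U} pts pts')
            (c ++ c' , λ x → trans (+-cong (u≋ x) (v≋ x)) (sym (lincomb-++ c c' w w' x)))

    cover-0ᵛ : ∀ {r v} → Cover r U v → Cover r U 0ᵛ
    cover-0ᵛ (cover w pts _) = cover w pts (0ᵛ , ≋-sym (lincomb-0ᶜ w))

    -- A nonzero vector needs at least one point, which can be repeated with coefficient 0.
    cover-suc : ∀ {a v} → ¬ (v ≋ 0ᵛ) → Cover a U v → Cover (suc a) U v
    cover-suc {zero}  v≢0 (cover _ _ (_ , v≋0)) = ⊥-elim (v≢0 v≋0)
    cover-suc {suc a} v≢0 cov@(cover w pts _) =
      cover-resp (λ x → trans (+-congʳ (zeroˡ _)) (+-identityˡ _))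
                 (cover-+ (cover-point (w Fin.zero) (pts Fin.zero) 0#) cov)

    cover-pad : ∀ {a b v} → ¬ (v ≋ 0ᵛ) → a ≤ b → Cover a U v → Cover b U v
    cover-pad {v = v} v≢0 a≤b = pad (ℕ.≤⇒≤′ a≤b)
      where
      pad : ∀ {a b} → a ℕ.≤′ b → Cover a U v → Cover b U v
      pad ℕ.≤′-refl        = λ cov → cov
      pad (ℕ.≤′-step a≤′b) = cover-suc v≢0 ∘ pad a≤′b

  cover-of-0ᵛ : ∀ {k t ρ} {U : Fin t → Subsp k} → SumRankSaturating ρ U → Cover ρ U 0ᵛ
  cover-of-0ᵛ {ρ = zero}          _                = cover-empty ≋-refl
  cover-of-0ᵛ {zero}  {ρ = suc _} (_ , minimal)    = ⊥-elim (ℕ.n≮0 (minimal 0 λ _ v≢0 → ⊥-elim (v≢0 λ ())))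
  cover-of-0ᵛ {suc k} {ρ = suc _} (covered , _)    =
    cover-0ᵛ (coveredBy⇒covers covered e₀ λ e₀≋0 → 0≉1 (sym (e₀≋0 Fin.zero)))
    where
    e₀ : Vec (suc k)
    e₀ Fin.zero    = 1#
    e₀ (Fin.suc _) = 0#

  cover-any : ∀ {k t ρ} {U : Fin t → Subsp k} → SumRankSaturating ρ U → ∀ v → Cover ρ U v
  cover-any sat v with v ≋? 0ᵛ
  ... | no  v≢0 = coveredBy⇒covers (proj₁ sat) v v≢0
  ... | yes v≋0 = cover-resp (≋-sym v≋0) (cover-of-0ᵛ sat)

  covers-mono : ∀ {k t r} {U U' : Fin t → Subsp k} → (∀ j v → U j v → U' j v) → Covers r U → Covers r U'
  covers-mono U⊆U' covers v v≢0 =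
    let cover w pts span = covers v v≢0
    in cover w (λ i → let ((j , w∈) , w≢0) = pts i in (j , U⊆U' j _ w∈) , w≢0) span

  saturating-transfer : ∀ {k t ρ} {U U' : Fin t → Subsp k} →
                        (∀ j v → (U j v → U' j v) × (U' j v → U j v)) →
                        SumRankSaturating ρ U → SumRankSaturating ρ U'
  saturating-transfer U≐U' (covered , minimal) =
      covers⇒coveredBy (covers-mono (λ j v → proj₁ (U≐U' j v)) (coveredBy⇒covers covered))
    , λ r covered' →
        minimal r (covers⇒coveredBy (covers-mono (λ j v → proj₂ (U≐U' j v)) (coveredBy⇒covers covered')))

  Needs : ∀ {k t} → ℕ → (Fin t → Subsp k) → Vec k → Set
  Needs ρ U v = ∀ a → Cover a U v → ρ ≤ a

  module Decision {k t : ℕ} {U : Fin t → Subsp k}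
                  (U? : ∀ j → Decidable (U j)) (U-resp : ∀ j → U j Respects _≋_) where

    point? : Decidable (PointOf U)
    point? w = Fin.any? (λ j → U? j w) ×-dec ¬? (w ≋? 0ᵛ)

    point-resp : PointOf U Respects _≋_
    point-resp u≋v ((j , u∈) , u≢0) = (j , U-resp j u≋v u∈) , u≢0 ∘ ≋-trans u≋v

    cover? : ∀ r → Decidable (Cover r U)
    cover? r v = map′ (λ (w , pts , span) → cover w pts span) (λ (cover w pts span) → w , pts , span)
      (Enumerable.∃? (Π-enumeration (Vec-enumeration k) r)
        (λ w≋w' (pts , c , v≋) → (λ i → point-resp (w≋w' i) (pts i)) , c , ≋-trans v≋ (lincomb-congʳ c w≋w'))
        (λ w → Fin.all? (point? ∘ w) ×-dec
               Enumerable.∃? (Vec-enumeration r) (λ c≋c' v≋ → ≋-trans v≋ (lincomb-congˡ w c≋c'))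
                                                 (λ c → v ≋? lincomb c w)))

    coveredBy? : ∀ r → Dec (CoveredBy r U)
    coveredBy? r = map′ covers⇒coveredBy coveredBy⇒covers
      (Enumerable.∀? (Vec-enumeration k)
        (λ u≋v covers v≢0 → cover-resp u≋v (covers (v≢0 ∘ ≋-trans (≋-sym u≋v))))
        (λ v → ¬? (v ≋? 0ᵛ) →-dec cover? r v))

    least-cover : ∀ {ρ} → CoveredBy ρ U → ∃[ ρ' ] (ρ' ≤ ρ × SumRankSaturating ρ' U)
    least-cover = least-≤ (λ r → CoveredBy r U) coveredBy? _

    needy-point : ∀ {ρ} → SumRankSaturating ρ U → ∃[ v ] (Needs ρ U v × (ρ ≡ 0 ⊎ ¬ (v ≋ 0ᵛ)))
    needy-point {zero}  _             = 0ᵛ , (λ _ _ → z≤n) , inj₁ ≡.refl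
    needy-point {suc ρ} (_ , minimal) with Enumerable.∃? (Vec-enumeration k)
        (λ u≋v (u≢0 , ¬cover) → u≢0 ∘ ≋-trans u≋v , ¬cover ∘ cover-resp (≋-sym u≋v))
        (λ v → ¬? (v ≋? 0ᵛ) ×-dec ¬? (cover? ρ v))
    ... | yes (v , v≢0 , ¬cover) = v , (λ a cov → ℕ.≰⇒> λ a≤ρ → ¬cover (cover-pad v≢0 a≤ρ cov)) , inj₂ v≢0
    ... | no  none = ⊥-elim (ℕ.1+n≰n (minimal ρ (covers⇒coveredBy λ v v≢0 →
                       decidable-stable (cover? ρ v) λ ¬cover → none (v , v≢0 , ¬cover))))

  module _ {k₁ k₂ : ℕ} where

    ++-cong : ∀ {u u' : Vec k₁} {v v' : Vec k₂} → u ≋ u' → v ≋ v' → (u ++ v) ≋ (u' ++ v')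
    ++-cong u≋u' v≋v' z with splitAt k₁ z
    ... | inj₁ x = u≋u' x
    ... | inj₂ y = v≋v' y

    take-++ : ∀ (u : Vec k₁) (v : Vec k₂) → take k₁ (u ++ v) ≋ u
    take-++ u v = reflexive ∘ lookup-++ˡ u v

    drop-++ : ∀ (u : Vec k₁) (v : Vec k₂) → drop k₁ (u ++ v) ≋ v
    drop-++ u v = reflexive ∘ lookup-++ʳ u v

    ≋-halves : ∀ {u v : Vec (k₁ ℕ.+ k₂)} → take k₁ u ≋ take k₁ v → drop k₁ u ≋ drop k₁ v → u ≋ v
    ≋-halves {u} {v} take≋ drop≋ z = ≡.subst (λ z → u z ≈ v z) (Fin.join-splitAt k₁ k₂ z) (by-half (splitAt k₁ z))
      where
      by-half : ∀ s → u (Fin.join k₁ k₂ s) ≈ v (Fin.join k₁ k₂ s)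
      by-half (inj₁ x) = take≋ x
      by-half (inj₂ y) = drop≋ y

    lincomb-stack : ∀ {r} (c : Vec r) (a : Fin r → Vec k₁) (b : Fin r → Vec k₂) →
                    lincomb c (λ i → a i ++ b i) ≋ (lincomb c a ++ lincomb c b)
    lincomb-stack c a b z with splitAt k₁ z
    ... | inj₁ _ = refl
    ... | inj₂ _ = refl

    module _ {r : ℕ} {a : Fin r → Vec k₁} {b : Fin r → Vec k₂} where

      span-take : ∀ {w} → InFSpan w (λ i → a i ++ b i) → InFSpan (take k₁ w) a
      span-take (c , c∈F , w≋) = c , c∈F , ≋-trans (w≋ ∘ (_↑ˡ k₂)) (lincomb-congʳ c (λ i → take-++ (a i) (b i)))

      span-drop : ∀ {w} → InFSpan w (λ i → a i ++ b i) → InFSpan (drop k₁ w) b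
      span-drop (c , c∈F , w≋) = c , c∈F , ≋-trans (w≋ ∘ (k₁ ↑ʳ_)) (lincomb-congʳ c (λ i → drop-++ (a i) (b i)))

      independent-take : FIndependent a → FIndependent (λ i → a i ++ b i)
      independent-take a-indep c c∈F cw≋0 =
        a-indep c c∈F (≋-trans (lincomb-congʳ c (λ i → ≋-sym (take-++ (a i) (b i)))) (cw≋0 ∘ (_↑ˡ k₂)))

      independent-drop : FIndependent b → FIndependent (λ i → a i ++ b i)
      independent-drop b-indep c c∈F cw≋0 =
        b-indep c c∈F (≋-trans (lincomb-congʳ c (λ i → ≋-sym (drop-++ (a i) (b i)))) (cw≋0 ∘ (k₁ ↑ʳ_)))

  span-of-0ᵛ : ∀ {k r} {v : Vec k} → InFSpan v (λ (_ : Fin r) → 0ᵛ) → v ≋ 0ᵛ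
  span-of-0ᵛ (c , _ , v≋) = ≋-trans v≋ (lincomb-0ʷ c)

  module FSum {k₁ k₂ t₁ t₂ : ℕ} {n₁ : Fin t₁ → ℕ} {n₂ : Fin t₂ → ℕ}
              (G₁ : GenMat k₁ t₁ n₁) (G₂ : GenMat k₂ t₂ n₂) (f : BVec t₁ n₁ → BVec t₂ n₂) where

    G : GenMat (k₁ ℕ.+ k₂) (t₁ ℕ.+ t₂) (n₁ ++ᶠ n₂)
    G = fSumGenMat G₁ G₂ f

    fColumn : ∀ j₂ → Fin (n₂ j₂) → Vec k₁
    fColumn j₂ c r₁ = f (row G₁ r₁) j₂ c

    left-block : ∀ j₁ {u} → systemOf G₁ j₁ u → systemOf G (j₁ ↑ˡ t₂) (u ++ 0ᵛ)
    left-block j₁ (c , c∈F , u≋) with splitAt t₁ (j₁ ↑ˡ t₂) | Fin.splitAt-↑ˡ t₁ j₁ t₂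
    ... | .(inj₁ j₁) | ≡.refl =
      c , c∈F , ≋-trans (++-cong u≋ (≋-sym (lincomb-0ʷ c))) (≋-sym (lincomb-stack c (column G₁ j₁) _))

    right-block : ∀ j₂ {u} → systemOf G₂ j₂ u → ∃[ w ] (systemOf G (t₁ ↑ʳ j₂) w × drop k₁ w ≋ u)
    right-block j₂ (c , c∈F , u≋) with splitAt t₁ (t₁ ↑ʳ j₂) | Fin.splitAt-↑ʳ t₁ t₂ j₂
    ... | .(inj₂ j₂) | ≡.refl =
      lincomb c (λ i → fColumn j₂ i ++ column G₂ j₂ i) , (c , c∈F , ≋-refl) ,
      ≋-trans (lincomb-congʳ c (λ i → drop-++ (fColumn j₂ i) (column G₂ j₂ i))) (≋-sym u≋)

    columns-independentᶠ : ColumnsIndependent G₁ → ColumnsIndependent G₂ → ColumnsIndependent G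
    columns-independentᶠ G₁-indep G₂-indep j with splitAt t₁ j
    ... | inj₁ j₁ = independent-take (G₁-indep j₁)
    ... | inj₂ j₂ = independent-drop (G₂-indep j₂)

    cover-inject : ∀ {r x} → Cover r (systemOf G₁) x → Cover r (systemOf G) (x ++ 0ᵛ)
    cover-inject (cover w pts (c , x≋)) =
      cover (λ i → w i ++ 0ᵛ) (λ i → inject (pts i))
            (c , ≋-trans (++-cong x≋ (≋-sym (lincomb-0ʷ c))) (≋-sym (lincomb-stack c w _)))
      where
      inject : ∀ {u} → PointOf (systemOf G₁) u → PointOf (systemOf G) (u ++ 0ᵛ)
      inject {u} ((j₁ , u∈) , u≢0) = (j₁ ↑ˡ t₂ , left-block j₁ u∈) ,
                                    λ u0≋0 → u≢0 (≋-trans (≋-sym (take-++ u 0ᵛ)) (u0≋0 ∘ (_↑ˡ k₂)))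

    cover-lift : ∀ {r y} → Cover r (systemOf G₂) y → ∃[ v ] (drop k₁ v ≋ y × Cover r (systemOf G) v)
    cover-lift {r} (cover w pts (c , y≋)) =
      lincomb c W , ≋-trans (lincomb-congʳ c (proj₂ ∘ proj₂ ∘ lift)) (≋-sym y≋) , cover W W-pts (c , ≋-refl)
      where
      lift : ∀ i → ∃[ W ] (systemOf G (t₁ ↑ʳ proj₁ (proj₁ (pts i))) W × drop k₁ W ≋ w i)
      lift i = right-block _ (proj₂ (proj₁ (pts i)))
      W : Fin r → Vec (k₁ ℕ.+ k₂)
      W = proj₁ ∘ lift
      W-pts : ∀ i → PointOf (systemOf G) (W i)
      W-pts i = (_ , proj₁ (proj₂ (lift i))) ,
                λ W≋0 → proj₂ (pts i) (≋-trans (≋-sym (proj₂ (proj₂ (lift i)))) (W≋0 ∘ (k₁ ↑ʳ_)))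

    -- v = (x, 0) + v₂, where v₂ lifts a cover of the lower half of v and x is the upper half of v − v₂.
    fSum-cover : ∀ {ρ₁ ρ₂} → (∀ x → Cover ρ₁ (systemOf G₁) x) → (∀ y → Cover ρ₂ (systemOf G₂) y) →
                 ∀ v → Cover (ρ₁ ℕ.+ ρ₂) (systemOf G) v
    fSum-cover cover₁ cover₂ v = cover-resp v≋ (cover-+ (cover-inject (cover₁ x)) cover-v₂)
      where
      lifted = cover-lift (cover₂ (drop k₁ v))
      v₂ = proj₁ lifted
      cover-v₂ = proj₂ (proj₂ lifted)
      x = take k₁ v -ᵛ take k₁ v₂
      v≋ : ((x ++ 0ᵛ) +ᵛ v₂) ≋ v
      v≋ = ≋-halves (λ i → trans (+-congʳ (take-++ x 0ᵛ i)) (//-rightDividesˡ _ _))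
                    (λ i → trans (+-congʳ (drop-++ x 0ᵛ i)) (trans (+-identityˡ _) (proj₁ (proj₂ lifted) i)))

    isSystem : ∀ {ρ₁ ρ₂} → ColumnsIndependent G₁ → ColumnsIndependent G₂ →
               (∀ x → Cover ρ₁ (systemOf G₁) x) → (∀ y → Cover ρ₂ (systemOf G₂) y) →
               IsSystem (n₁ ++ᶠ n₂) (systemOf G)
    isSystem G₁-indep G₂-indep cover₁ cover₂ =
        (λ j → span-isFSubspace (column G j))
      , (λ j → columns-basis G j (columns-independentᶠ G₁-indep G₂-indep j))
      , λ v → let cover w pts span = fSum-cover cover₁ cover₂ v in _ , w , proj₁ ∘ pts , span

  module DirectSum {k₁ k₂ t₁ t₂ : ℕ} {n₁ : Fin t₁ → ℕ} {n₂ : Fin t₂ → ℕ}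
                   (G₁ : GenMat k₁ t₁ n₁) (G₂ : GenMat k₂ t₂ n₂) where

    open FSum G₁ G₂ (λ _ _ _ → 0#) public

    block-point : ∀ j {w} → systemOf G j w →
                  (∃[ j₁ ] (systemOf G₁ j₁ (take k₁ w) × drop k₁ w ≋ 0ᵛ))
                  ⊎ (∃[ j₂ ] (systemOf G₂ j₂ (drop k₁ w) × take k₁ w ≋ 0ᵛ))
    block-point j w∈ with splitAt t₁ j
    ... | inj₁ j₁ = inj₁ (j₁ , span-take w∈ , span-of-0ᵛ (span-drop w∈))
    ... | inj₂ j₂ = inj₂ (j₂ , span-drop w∈ , span-of-0ᵛ (span-take w∈))

    cover-split : ∀ r {v} → Cover r (systemOf G) v →
                  ∃₂ λ a b → a ℕ.+ b ≡ r × Cover a (systemOf G₁) (take k₁ v) × Cover b (systemOf G₂) (drop k₁ v)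
    cover-split zero (cover _ _ (_ , v≋0)) =
      0 , 0 , ≡.refl , cover-empty (v≋0 ∘ (_↑ˡ k₂)) , cover-empty (v≋0 ∘ (k₁ ↑ʳ_))
    cover-split (suc r) (cover w pts (c , v≋))
      with cover-split r (cover (w ∘ Fin.suc) (pts ∘ Fin.suc) (c ∘ Fin.suc , ≋-refl)) | pts Fin.zero
    ... | a , b , a+b≡r , cover-a , cover-b | (j , w₀∈) , w₀≢0 with block-point j w₀∈
    ... | inj₁ (j₁ , take∈ , drop≋0) =
      suc a , b , cong suc a+b≡r ,
      cover-resp (≋-sym (v≋ ∘ (_↑ˡ k₂))) (cover-+ (cover-point _ ((j₁ , take∈) , take≢0) (c Fin.zero)) cover-a) ,
      cover-resp (λ y → sym (trans (v≋ (k₁ ↑ʳ y)) (x≈0⇒a*x+y≈y _ _ (drop≋0 y)))) cover-b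
      where
      take≢0 : ¬ (take k₁ (w Fin.zero) ≋ 0ᵛ)
      take≢0 take≋0 = w₀≢0 (≋-halves take≋0 drop≋0)
    ... | inj₂ (j₂ , drop∈ , take≋0) =
      a , suc b , ≡.trans (ℕ.+-suc a b) (cong suc a+b≡r) ,
      cover-resp (λ x → sym (trans (v≋ (x ↑ˡ k₂)) (x≈0⇒a*x+y≈y _ _ (take≋0 x)))) cover-a ,
      cover-resp (≋-sym (v≋ ∘ (k₁ ↑ʳ_))) (cover-+ (cover-point _ ((j₂ , drop∈) , drop≢0) (c Fin.zero)) cover-b)
      where
      drop≢0 : ¬ (drop k₁ (w Fin.zero) ≋ 0ᵛ)
      drop≢0 drop≋0 = w₀≢0 (≋-halves take≋0 drop≋0)

    needs-++ : ∀ {ρ₁ ρ₂ v₁ v₂} → Needs ρ₁ (systemOf G₁) v₁ → Needs ρ₂ (systemOf G₂) v₂ →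
               Needs (ρ₁ ℕ.+ ρ₂) (systemOf G) (v₁ ++ v₂)
    needs-++ {v₁ = v₁} {v₂} needs₁ needs₂ r cov =
      let (a , b , a+b≡r , cover-a , cover-b) = cover-split r cov
      in ≡.subst (_ ≤_) a+b≡r (ℕ.+-mono-≤ (needs₁ a (cover-resp (take-++ v₁ v₂) cover-a))
                                           (needs₂ b (cover-resp (drop-++ v₁ v₂) cover-b)))

    saturating : ∀ {ρ₁ ρ₂} → SumRankSaturating ρ₁ (systemOf G₁) → SumRankSaturating ρ₂ (systemOf G₂) →
                 SumRankSaturating (ρ₁ ℕ.+ ρ₂) (systemOf G)
    saturating sat₁ sat₂ =
        covers⇒coveredBy (λ v _ → fSum-cover (cover-any sat₁) (cover-any sat₂) v)
      , minimal (Decision.needy-point (systemOf? G₁) (systemOf-resp G₁) sat₁)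
                (Decision.needy-point (systemOf? G₂) (systemOf-resp G₂) sat₂)
      where
      minimal : ∀ {ρ₁ ρ₂} → ∃[ v₁ ] (Needs ρ₁ (systemOf G₁) v₁ × (ρ₁ ≡ 0 ⊎ ¬ (v₁ ≋ 0ᵛ))) →
                ∃[ v₂ ] (Needs ρ₂ (systemOf G₂) v₂ × (ρ₂ ≡ 0 ⊎ ¬ (v₂ ≋ 0ᵛ))) →
                ∀ r → CoveredBy r (systemOf G) → ρ₁ ℕ.+ ρ₂ ≤ r
      minimal (_ , _ , inj₁ ≡.refl) (_ , _ , inj₁ ≡.refl) _ _ = z≤n
      minimal (v₁ , needs₁ , inj₂ v₁≢0) (v₂ , needs₂ , _) r covered =
        needs-++ needs₁ needs₂ r (coveredBy⇒covers covered (v₁ ++ v₂)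
          λ v≋0 → v₁≢0 (≋-trans (≋-sym (take-++ v₁ v₂)) (v≋0 ∘ (_↑ˡ k₂))))
      minimal (v₁ , needs₁ , inj₁ _) (v₂ , needs₂ , inj₂ v₂≢0) r covered =
        needs-++ needs₁ needs₂ r (coveredBy⇒covers covered (v₁ ++ v₂)
          λ v≋0 → v₂≢0 (≋-trans (≋-sym (drop-++ v₁ v₂)) (v≋0 ∘ (k₁ ↑ʳ_))))

  fSum-saturating : ∀ {k₁ k₂ t₁ t₂ : ℕ} (n₁ : Fin t₁ → ℕ) (n₂ : Fin t₂ → ℕ)
                    (U₁ : Fin t₁ → Subsp k₁) (U₂ : Fin t₂ → Subsp k₂) (ρ₁ ρ₂ : ℕ)
                    (G₁ : GenMat k₁ t₁ n₁) (G₂ : GenMat k₂ t₂ n₂) →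
                    IsSystem n₁ U₁ → SumRankSaturating ρ₁ U₁ → IsGenMatOf G₁ U₁ →
                    IsSystem n₂ U₂ → SumRankSaturating ρ₂ U₂ → IsGenMatOf G₂ U₂ →
                    (f : BVec t₁ n₁ → BVec t₂ n₂) → IsKLinear f →
                    IsSystem (n₁ ++ᶠ n₂) (fSumSystem G₁ G₂ f)
                    × ∃[ ρ ] (ρ ≤ ρ₁ ℕ.+ ρ₂ × SumRankSaturating ρ (fSumSystem G₁ G₂ f))
  fSum-saturating _ _ _ _ _ _ G₁ G₂ sys₁ sat₁ G₁≐U₁ sys₂ sat₂ G₂≐U₂ f _ =
      FSum.isSystem G₁ G₂ f (columns-independent sys₁ G₁≐U₁) (columns-independent sys₂ G₂≐U₂) cover₁ cover₂
    , Decision.least-cover (systemOf? G) (systemOf-resp G)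
                           (covers⇒coveredBy λ v _ → FSum.fSum-cover G₁ G₂ f cover₁ cover₂ v)
    where
    G = fSumGenMat G₁ G₂ f
    cover₁ = cover-any (saturating-transfer G₁≐U₁ sat₁)
    cover₂ = cover-any (saturating-transfer G₂≐U₂ sat₂)

  -- The bound ρ₁ + ρ₂ ≤ min{k₁ + k₂, m} only guarantees that s exists; here the value s is given.
  s-subadditive : ∀ (k₁ k₂ t₁ t₂ ρ₁ ρ₂ : ℕ) → ρ₁ ℕ.+ ρ₂ ≤ (k₁ ℕ.+ k₂) ℕ.⊓ m →
                  ∀ (s s₁ s₂ : ℕ) →
                  IsSValue (k₁ ℕ.+ k₂) (ρ₁ ℕ.+ ρ₂) (t₁ ℕ.+ t₂) s →
                  IsSValue k₁ ρ₁ t₁ s₁ → IsSValue k₂ ρ₂ t₂ s₂ →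
                  s ≤ s₁ ℕ.+ s₂
  s-subadditive _ _ _ _ _ _ _ s _ _ (_ , s-minimal)
                ((_ , n₁ , sys₁ , sat₁ , ≡.refl) , _) ((_ , n₂ , sys₂ , sat₂ , ≡.refl) , _) =
    ≡.subst (s ≤_) (∑ℕ-++ n₁ n₂)
      (s-minimal _ (n₁ ++ᶠ n₂) (DirectSum.isSystem G₁ G₂ indep₁ indep₂ (cover-any sat₁′) (cover-any sat₂′))
                               (DirectSum.saturating G₁ G₂ sat₁′ sat₂′))
    where
    G₁ = basisMatrix sys₁
    G₂ = basisMatrix sys₂
    sat₁′ = saturating-transfer (basisMatrix-isGenMat sys₁) sat₁
    sat₂′ = saturating-transfer (basisMatrix-isGenMat sys₂) sat₂
    indep₁ = columns-independent sys₁ (basisMatrix-isGenMat sys₁)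
    indep₂ = columns-independent sys₂ (basisMatrix-isGenMat sys₂)

open import Data.Nat using (_+_; _⊓_)

proposition3p11 :
    (q m : ℕ) → IsPrimePower q → 1 ≤ m → (E : Extension q m) →
    let open Over E in
      ( ∀ {k1 k2 t1 t2 : ℕ} (n1 : Fin t1 → ℕ) (n2 : Fin t2 → ℕ)
          (U1 : Fin t1 → Subsp k1) (U2 : Fin t2 → Subsp k2) (ρ1 ρ2 : ℕ)
          (G1 : GenMat k1 t1 n1) (G2 : GenMat k2 t2 n2) →
          IsSystem n1 U1 → SumRankSaturating ρ1 U1 → IsGenMatOf G1 U1 →
          IsSystem n2 U2 → SumRankSaturating ρ2 U2 → IsGenMatOf G2 U2 →
          (f : BVec t1 n1 → BVec t2 n2) → IsKLinear f →
          IsSystem (n1 ++ᶠ n2) (fSumSystem G1 G2 f)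
          × ∃[ ρ ] (ρ ≤ ρ1 + ρ2 × SumRankSaturating ρ (fSumSystem G1 G2 f)) )
      × ( ∀ (k1 k2 t1 t2 ρ1 ρ2 : ℕ) → ρ1 + ρ2 ≤ (k1 + k2) ⊓ m →
          ∀ (s s1 s2 : ℕ) →
          IsSValue (k1 + k2) (ρ1 + ρ2) (t1 + t2) s →
          IsSValue k1 ρ1 t1 s1 → IsSValue k2 ρ2 t2 s2 →
          s ≤ s1 + s2 )
proposition3p11 q m _ _ E = SumRankSystems.fSum-saturating E , SumRankSystems.s-subadditive E
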